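{- Let $s_1\ge s_2\ge 0$ be integers and let $1\le m\le s_1+s_2$. Consider the $m$-round $(s_1,s_2)$-game (card values $1,2$), and suppose the player names Value $1$ exactly $b_1$ times and Value $2$ exactly $b_2$ times during the $m$ rounds, where $b_1+b_2=m$. Then the probability that the player wins is $$\binom{s_1+s_2-b_1-b_2}{s_1-b_2}\binom{s_1+s_2}{s_1}^{ -1}.$$ (This is non-zero if and only if $b_1\le s_2$ and $b_2\le s_1$.) In particular, if $m\le s_1-s_2$, then the unique optimal strategy is to name Value $2$ in every round. Otherwise, the optimal strategies are exactly those for which the numbers $s_1-b_2$ and $s_2-b_1$ differ by at most $1$.
   Context: For a vector $\mathbf s=(s_1,\dots,s_v)$ of non-negative integers, the $\mathbf s$-deck consists of $s_i$ cards of Value $i$ for each $i\in\{1,\dots,v\}$; let $\Sigma(\mathbf s)=s_1+\dots+s_v$. In the $m$-round $\mathbf s$-game ($m\le\Sigma(\mathbf s)$), the deck is shuffled uniformly at random (all orderings equally likely); there are $m$ rounds, and in each round the player names a value in $\{1,\dots,v\}$ (a bid) and then the top card of the remaining deck is turned face up. A coincidence occurs in a round if the turned card has the named value. The player wins if there is no coincidence in any of the $m$ rounds. The player knows $m$ and $\mathbf s$ in advance and may choose each bid depending on the cards revealed so far. A strategy is optimal if it maximizes the probability of winning. ($\binom{n}{k}$ is taken to be $0$ when $k<0$ or $k>n$.) -}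

module Defs where

open import Data.Nat using (ℕ; zero; suc; _+_; _∸_)
open import Data.Nat.Combinatorics using (_C_)
open import Data.Integer using (ℤ; +_; -[1+_])
open import Data.Rational using (ℚ; _/_; 0ℚ)
open import Data.List using (List; []; _∷_; _++_; [_]; map; concatMap; replicate)
open import Data.Nat.ListAction using (sum)
open import Data.Bool using (Bool; true; false; if_then_else_; _∧_; not)

data Val : Set where
  v1 v2 : Val

_==_ : Val → Val → Bool
v1 == v1 = true
v2 == v2 = true
_ == _ = false

other : Val → Val
other v1 = v2
other v2 = v1

-- A (deterministic) strategy: the bid as a function of the list of cards
-- revealed so far (in chronological order; its length is the round index).
Strategy : Set
Strategy = List Val → Val

deck : ℕ → ℕ → List Val
deck s1 s2 = replicate s1 v1 ++ replicate s2 v2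

-- All orderings of a list of (distinct, labelled) cards, with multiplicity:
-- a list of length (length xs)!, each ordering of the labelled cards once.
insertions : Val → List Val → List (List Val)
insertions x [] = [ x ∷ [] ]
insertions x (y ∷ ys) = (x ∷ y ∷ ys) ∷ map (y ∷_) (insertions x ys)

perms : List Val → List (List Val)
perms [] = [ [] ]
perms (x ∷ xs) = concatMap (insertions x) (perms xs)

winsFrom : Strategy → List Val → ℕ → List Val → Bool
winsFrom σ hist zero w = true
winsFrom σ hist (suc k) [] = true
winsFrom σ hist (suc k) (c ∷ w) = not (σ hist == c) ∧ winsFrom σ (hist ++ [ c ]) k w

winCount : ℕ → ℕ → ℕ → Strategy → ℕ
winCount s1 s2 m σ =
  sum (map (λ w → if winsFrom σ [] m w then 1 else 0) (perms (deck s1 s2)))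

totalCount : ℕ → ℕ → ℕ
totalCount s1 s2 = sum (map (λ _ → 1) (perms (deck s1 s2)))

-- a / b as a rational number (b = 0 never occurs in our uses; then 0).
frac : ℕ → ℕ → ℚ
frac a zero = 0ℚ
frac a (suc b) = (+ a) / suc b

winProb : ℕ → ℕ → ℕ → Strategy → ℚ
winProb s1 s2 m σ = frac (winCount s1 s2 m σ) (totalCount s1 s2)

-- Bids made by σ along the unique run in which no coincidence occurs
-- (in each round the revealed card is the value not named), for k rounds.
-- These are the bids "during the m rounds" whenever the player wins;
-- on every other run the game is already lost.
bidsFrom : Strategy → List Val → ℕ → List Val
bidsFrom σ hist zero = []
bidsFrom σ hist (suc k) = σ hist ∷ bidsFrom σ (hist ++ [ other (σ hist) ]) k

bids : Strategy → ℕ → List Val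
bids σ m = bidsFrom σ [] m

count : Val → List Val → ℕ
count v [] = 0
count v (x ∷ xs) = (if v == x then 1 else 0) + count v xs

-- Binomial coefficient with an integer lower index (0 if k < 0 or k > n).
binomℤ : ℕ → ℤ → ℕ
binomℤ n (+ k) = n C k
binomℤ n -[1+ k ] = 0

module Submission where

-- A run has no coincidence exactly when every revealed card is the value not named, so σ wins
-- on precisely those orderings of the deck that begin with the word `map other (bids σ m)`.
-- Counting the orderings of the labelled deck by their prefix (a permutation is built by
-- inserting one card at a time) shows that s1↓b2 · s2↓b1 · (s1 + s2 − m)! of the (s1 + s2)!
-- orderings are winning, which is C(s1 + s2 − m, s1 − b2) / C(s1 + s2, s1).
-- As b1 + b2 = m, trading a bid on Value 1 for a bid on Value 2 multiplies s1↓b2 · s2↓b1 by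
-- (s1 − b2) / (s2 − b1 + 1), so the product is unimodal along b1 + b2 = m and maximal exactly
-- when s1 − b2 and s2 − b1 differ by at most one, or at b1 = 0 when s2 + m ≤ s1. Every split
-- of m is realised by some strategy, so these splits characterise the optimal strategies.

open import Defs
open import Data.Bool using (Bool; true; false; if_then_else_; _∧_; T)
open import Data.Integer using (+_; ∣_∣; _⊖_) renaming (_-_ to _-ℤ_)
import Data.Integer as ℤ
import Data.Integer.Properties as ℤₚ
import Data.Integer.Tactic.RingSolver as ℤ-Solver
open import Data.List using (List; []; _∷_; _++_; [_]; map; concatMap; replicate; length)
open import Data.List.Properties using (map-++; map-∘; map-cong; map-cong-local; length-map; length-++; length-replicate)
open import Data.List.Relation.Unary.All as All using (All; []; _∷_)
open import Data.List.Relation.Unary.All.Properties using (map⁺; concat⁺)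
open import Data.Nat
open import Data.Nat.Combinatorics using (_C_; nCk≡n!/k![n-k]!; k![n∸k]!∣n!; k>n⇒nCk≡0)
open import Data.Nat.DivMod using (m/n*n≡m)
open import Data.Nat.ListAction using (sum)
open import Data.Nat.ListAction.Properties using (sum-++)
open import Data.Nat.Properties
open import Algebra.Properties.CommutativeSemigroup *-commutativeSemigroup using (x∙yz≈y∙xz)
open import Data.Nat.Tactic.RingSolver using (solve-∀)
open import Data.Product using (_×_; _,_; Σ; ∃₂; swap)
open import Data.Rational using (0ℚ; toℚᵘ) renaming (_≤_ to _≤ℚ_)
import Data.Rational.Properties as ℚ
import Data.Rational.Unnormalised as ℚᵘ
import Data.Rational.Unnormalised.Properties as ℚᵘ
open import Data.Sum using (inj₁; inj₂)
open import Data.Unit using (tt)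
open import Function.Base using (_∘′_)
open import Function.Bundles using (_⇔_; mk⇔; Equivalence)
import Function.Properties.Equivalence as ⇔
open import Relation.Binary.PropositionalEquality hiding ([_])
open import Relation.Nullary using (¬_; Dec; yes; no; contradiction)
open import Relation.Nullary.Decidable using (_×-dec_)
open ≡-Reasoning

private variable A B : Set

-- Sums over lists

∑ : List A → (A → ℕ) → ℕ
∑ xs f = sum (map f xs)

syntax ∑ xs (λ x → e) = ∑[ x ∈ xs ] e

∑-++ : (xs ys : List A) (f : A → ℕ) → ∑ (xs ++ ys) f ≡ ∑ xs f + ∑ ys f
∑-++ xs ys f = trans (cong sum (map-++ f xs ys)) (sum-++ (map f xs) (map f ys))

∑-cong : (xs : List A) {f g : A → ℕ} → (∀ x → f x ≡ g x) → ∑ xs f ≡ ∑ xs g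
∑-cong xs f≗g = cong sum (map-cong f≗g xs)

∑-cong-All : {xs : List A} {f g : A → ℕ} → All (λ x → f x ≡ g x) xs → ∑ xs f ≡ ∑ xs g
∑-cong-All eqs = cong sum (map-cong-local eqs)

∑-0 : (xs : List A) → ∑[ _ ∈ xs ] 0 ≡ 0
∑-0 [] = refl
∑-0 (_ ∷ xs) = ∑-0 xs

∑-1 : (xs : List A) → ∑[ _ ∈ xs ] 1 ≡ length xs
∑-1 [] = refl
∑-1 (_ ∷ xs) = cong suc (∑-1 xs)

∑-+ : (xs : List A) (f g : A → ℕ) → ∑[ x ∈ xs ] (f x + g x) ≡ ∑ xs f + ∑ xs g
∑-+ [] f g = refl
∑-+ (x ∷ xs) f g rewrite ∑-+ xs f g = +-comm-middle (f x) (g x) (∑ xs f) (∑ xs g)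
  where
  +-comm-middle : ∀ a b c d → a + b + (c + d) ≡ a + c + (b + d)
  +-comm-middle = solve-∀

∑-*ˡ : (c : ℕ) (xs : List A) (f : A → ℕ) → ∑[ x ∈ xs ] (c * f x) ≡ c * ∑ xs f
∑-*ˡ c [] f = sym (*-zeroʳ c)
∑-*ˡ c (x ∷ xs) f rewrite ∑-*ˡ c xs f = sym (*-distribˡ-+ c (f x) (∑ xs f))

∑-map : (g : A → B) (xs : List A) (f : B → ℕ) → ∑ (map g xs) f ≡ ∑[ x ∈ xs ] f (g x)
∑-map g xs f = cong sum (sym (map-∘ xs))

∑-concatMap : (g : A → List B) (xs : List A) (f : B → ℕ) →
  ∑ (concatMap g xs) f ≡ ∑[ x ∈ xs ] ∑ (g x) f
∑-concatMap g [] f = refl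
∑-concatMap g (x ∷ xs) f =
  trans (∑-++ (g x) (concatMap g xs) f) (cong (_+_ (∑ (g x) f)) (∑-concatMap g xs f))

∑-comm : (xs : List A) (ys : List B) (g : A → B → ℕ) →
  ∑[ y ∈ ys ] ∑[ x ∈ xs ] g x y ≡ ∑[ x ∈ xs ] ∑[ y ∈ ys ] g x y
∑-comm [] ys g = ∑-0 ys
∑-comm (x ∷ xs) ys g =
  trans (∑-+ ys (g x) (λ y → ∑[ x′ ∈ xs ] g x′ y)) (cong (_+_ (∑ ys (g x))) (∑-comm xs ys g))

χ : Bool → ℕ
χ b = if b then 1 else 0

χ-∧ : ∀ a b → χ (a ∧ b) ≡ χ a * χ b
χ-∧ true b = sym (+-identityʳ (χ b))
χ-∧ false b = refl

∑-χ-∧ : (b : Bool) (xs : List A) (f : A → Bool) →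
  ∑[ x ∈ xs ] χ (b ∧ f x) ≡ χ b * ∑[ x ∈ xs ] χ (f x)
∑-χ-∧ b xs f = trans (∑-cong xs (λ x → χ-∧ b (f x))) (∑-*ˡ (χ b) xs (χ ∘′ f))

∑-if-∷ : (b : Bool) (x : A) (xs : List A) (f : A → ℕ) →
  ∑ (if b then x ∷ xs else xs) f ≡ χ b * f x + ∑ xs f
∑-if-∷ true x xs f = cong (_+ ∑ xs f) (sym (*-identityˡ (f x)))
∑-if-∷ false x xs f = refl

-- Falling factorials

infixl 8 _↓_
_↓_ : ℕ → ℕ → ℕ
a ↓ zero = 1
zero ↓ suc c = 0
suc a ↓ suc c = suc a * (a ↓ c)

↓-step : ∀ a c → a ↓ suc c ≡ (a ∸ c) * a ↓ c
↓-step zero zero = refl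
↓-step zero (suc c) = refl
↓-step (suc a) zero = refl
↓-step (suc a) (suc c) = begin
  suc a * a ↓ suc c           ≡⟨ cong (suc a *_) (↓-step a c) ⟩
  suc a * ((a ∸ c) * a ↓ c)   ≡⟨ x∙yz≈y∙xz (suc a) (a ∸ c) (a ↓ c) ⟩
  (a ∸ c) * (suc a * a ↓ c)   ∎

↓-zero : ∀ {a c} → a < c → a ↓ c ≡ 0
↓-zero {zero} {suc c} _ = refl
↓-zero {suc a} {suc c} (s≤s a<c) rewrite ↓-zero a<c = *-zeroʳ (suc a)

↓-pos : ∀ {a c} → c ≤ a → 0 < a ↓ c
↓-pos {a} {zero} _ = z<s
↓-pos {suc a} {suc c} (s≤s c≤a) = *-mono-< (z<s {n = a}) (↓-pos c≤a)

↓-pascal : ∀ a c → suc a ↓ suc c ≡ a ↓ suc c + suc c * a ↓ c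
↓-pascal a c with c ≤? a
... | yes c≤a = begin
  suc a * a ↓ c                     ≡⟨ cong (_* a ↓ c) (sym (trans (+-suc (a ∸ c) c) (cong suc (m∸n+n≡m c≤a)))) ⟩
  (a ∸ c + suc c) * a ↓ c           ≡⟨ *-distribʳ-+ (a ↓ c) (a ∸ c) (suc c) ⟩
  (a ∸ c) * a ↓ c + suc c * a ↓ c   ≡⟨ cong (_+ suc c * a ↓ c) (sym (↓-step a c)) ⟩
  a ↓ suc c + suc c * a ↓ c         ∎
... | no c≰a rewrite ↓-zero (≰⇒> c≰a) | ↓-zero (m<n⇒m<1+n (≰⇒> c≰a)) = trans (*-zeroʳ (suc a)) (sym (*-zeroʳ (suc c)))

↓-*-! : ∀ c p → (c + p) ↓ c * p ! ≡ (c + p) !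
↓-*-! zero p = +-identityʳ (p !)
↓-*-! (suc c) p = trans (*-assoc (suc (c + p)) ((c + p) ↓ c) (p !)) (cong (suc (c + p) *_) (↓-*-! c p))

↓*↓-zero : ∀ {a b c d} → a + b < c + d → a ↓ c * b ↓ d ≡ 0
↓*↓-zero {a} {b} {c} {d} a+b<c+d with a <? c
... | yes a<c rewrite ↓-zero a<c = refl
... | no a≮c rewrite ↓-zero (+-cancelˡ-< a b d (<-≤-trans a+b<c+d (+-monoˡ-≤ d (≮⇒≥ a≮c)))) = *-zeroʳ (a ↓ c)

↓*↓-sucˡ : ∀ a b i r → a ↓ suc i * b ↓ r ≡ (a ∸ i) * (a ↓ i * b ↓ r)
↓*↓-sucˡ a b i r = trans (cong (_* b ↓ r) (↓-step a i)) (*-assoc (a ∸ i) (a ↓ i) (b ↓ r))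

↓*↓-sucʳ : ∀ a b i r → a ↓ i * b ↓ suc r ≡ (b ∸ r) * (a ↓ i * b ↓ r)
↓*↓-sucʳ a b i r = trans (cong (a ↓ i *_) (↓-step b r)) (x∙yz≈y∙xz (a ↓ i) (b ∸ r) (b ↓ r))

-- Orderings of a deck with a given prefix

==-sym : ∀ x y → (x == y) ≡ (y == x)
==-sym v1 v1 = refl
==-sym v1 v2 = refl
==-sym v2 v1 = refl
==-sym v2 v2 = refl

count-∷-self : ∀ x l → count x (x ∷ l) ≡ suc (count x l)
count-∷-self v1 l = refl
count-∷-self v2 l = refl

count-∷-other : ∀ x l → count (other x) (x ∷ l) ≡ count (other x) l
count-∷-other v1 l = refl
count-∷-other v2 l = refl

count+count-other : ∀ x l → count x l + count (other x) l ≡ length l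
count+count-other x [] = refl
count+count-other v1 (v1 ∷ l) = cong suc (count+count-other v1 l)
count+count-other v1 (v2 ∷ l) = trans (+-suc (count v1 l) _) (cong suc (count+count-other v1 l))
count+count-other v2 (v1 ∷ l) = trans (+-suc (count v2 l) _) (cong suc (count+count-other v2 l))
count+count-other v2 (v2 ∷ l) = cong suc (count+count-other v2 l)

count-++ : ∀ x l l′ → count x (l ++ l′) ≡ count x l + count x l′
count-++ x [] l′ = refl
count-++ x (y ∷ l) l′ = trans (cong (_+_ (χ (x == y))) (count-++ x l l′)) (sym (+-assoc (χ (x == y)) _ _))

count-replicate : ∀ x n → count x (replicate n x) ≡ n
count-replicate x zero = refl
count-replicate x (suc n) = trans (count-∷-self x (replicate n x)) (cong suc (count-replicate x n))

count-other-replicate : ∀ x n → count (other x) (replicate n x) ≡ 0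
count-other-replicate x zero = refl
count-other-replicate x (suc n) = trans (count-∷-other x (replicate n x)) (count-other-replicate x n)

count-map-other : ∀ x l → count x (map other l) ≡ count (other x) l
count-map-other x [] = refl
count-map-other v1 (v1 ∷ l) = count-map-other v1 l
count-map-other v1 (v2 ∷ l) = cong suc (count-map-other v1 l)
count-map-other v2 (v1 ∷ l) = cong suc (count-map-other v2 l)
count-map-other v2 (v2 ∷ l) = count-map-other v2 l

infix 4 _⊑ᵇ_
_⊑ᵇ_ : List Val → List Val → Bool
[] ⊑ᵇ w = true
(x ∷ t) ⊑ᵇ [] = false
(x ∷ t) ⊑ᵇ (c ∷ w) = (x == c) ∧ (t ⊑ᵇ w)

countWithPrefix : List Val → List (List Val) → ℕ
countWithPrefix t ws = ∑[ w ∈ ws ] χ (t ⊑ᵇ w)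

deletions : Val → List Val → List (List Val)
deletions x [] = []
deletions x (z ∷ t) = if x == z then t ∷ map (z ∷_) (deletions x t) else map (z ∷_) (deletions x t)

length-insertions : ∀ x w → length (insertions x w) ≡ suc (length w)
length-insertions x [] = refl
length-insertions x (y ∷ w) = cong suc (trans (length-map (y ∷_) (insertions x w)) (length-insertions x w))

insertions-lengths : ∀ x w → All (λ u → length u ≡ suc (length w)) (insertions x w)
insertions-lengths x [] = refl ∷ []
insertions-lengths x (y ∷ w) = refl ∷ map⁺ (All.map (cong suc) (insertions-lengths x w))

perms-lengths : ∀ L → All (λ w → length w ≡ length L) (perms L)
perms-lengths [] = refl ∷ []
perms-lengths (x ∷ L) = concat⁺ (map⁺ (All.map lengths-after-insertion (perms-lengths L)))
  where
  lengths-after-insertion : ∀ {w} → length w ≡ length L → All (λ u → length u ≡ suc (length L)) (insertions x w)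
  lengths-after-insertion {w} eq = All.map (λ e → trans e (cong suc eq)) (insertions-lengths x w)

∑-∷-⊑ᵇ-∷ : ∀ z y ts w → ∑[ t ∈ map (z ∷_) ts ] χ (t ⊑ᵇ y ∷ w) ≡ χ (z == y) * ∑[ t ∈ ts ] χ (t ⊑ᵇ w)
∑-∷-⊑ᵇ-∷ z y ts w = trans (∑-map (z ∷_) ts _) (∑-χ-∧ (z == y) ts (_⊑ᵇ w))

-- Inserting x at one of the positions ∣t∣, …, ∣w∣ leaves t a prefix iff t ⊑ w; inserting it at a
-- position p < ∣t∣ gives the prefix t iff t has x at p and t with that x deleted is a prefix of w.
countWithPrefix-insertions : ∀ x w t → countWithPrefix t (insertions x w) ≡
  (suc (length w) ∸ length t) * χ (t ⊑ᵇ w) + ∑[ t′ ∈ deletions x t ] χ (t′ ⊑ᵇ w)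
countWithPrefix-insertions x w [] = begin
  ∑[ _ ∈ insertions x w ] 1           ≡⟨ ∑-1 (insertions x w) ⟩
  length (insertions x w)             ≡⟨ length-insertions x w ⟩
  suc (length w)                      ≡⟨ sym (trans (+-identityʳ _) (*-identityʳ _)) ⟩
  suc (length w) * 1 + 0              ∎
countWithPrefix-insertions x [] (z ∷ t) = begin
  χ ((z == x) ∧ (t ⊑ᵇ [])) + 0          ≡⟨ +-identityʳ _ ⟩
  χ ((z == x) ∧ (t ⊑ᵇ []))              ≡⟨ χ-∧ (z == x) _ ⟩
  χ (z == x) * χ (t ⊑ᵇ [])              ≡⟨ cong (λ b → χ b * χ (t ⊑ᵇ [])) (==-sym z x) ⟩
  χ (x == z) * χ (t ⊑ᵇ [])              ≡⟨ sym (trans (cong (_+_ (χ (x == z) * χ (t ⊑ᵇ []))) no-cons-prefix-of-[]) (+-identityʳ _)) ⟩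
  χ (x == z) * χ (t ⊑ᵇ []) + ∑[ t′ ∈ map (z ∷_) (deletions x t) ] χ (t′ ⊑ᵇ [])
    ≡⟨ sym (∑-if-∷ (x == z) t (map (z ∷_) (deletions x t)) (λ t′ → χ (t′ ⊑ᵇ []))) ⟩
  ∑[ t′ ∈ deletions x (z ∷ t) ] χ (t′ ⊑ᵇ [])
    ≡⟨ cong (λ k → k * χ (z ∷ t ⊑ᵇ []) + ∑[ t′ ∈ deletions x (z ∷ t) ] χ (t′ ⊑ᵇ [])) (sym (0∸n≡0 (length t))) ⟩
  (0 ∸ length t) * χ (z ∷ t ⊑ᵇ []) + ∑[ t′ ∈ deletions x (z ∷ t) ] χ (t′ ⊑ᵇ []) ∎
  where
  no-cons-prefix-of-[] : ∑[ t′ ∈ map (z ∷_) (deletions x t) ] χ (t′ ⊑ᵇ []) ≡ 0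
  no-cons-prefix-of-[] = trans (∑-map (z ∷_) (deletions x t) _) (∑-0 (deletions x t))
countWithPrefix-insertions x (y ∷ w) (z ∷ t) = begin
  χ ((z == x) ∧ (t ⊑ᵇ y ∷ w)) + ∑[ u ∈ map (y ∷_) (insertions x w) ] χ (z ∷ t ⊑ᵇ u)
    ≡⟨ cong₂ _+_ (trans (χ-∧ (z == x) _) (cong (λ b → χ b * _) (==-sym z x)))
                 (trans (∑-map (y ∷_) (insertions x w) _) (∑-χ-∧ (z == y) (insertions x w) (t ⊑ᵇ_))) ⟩
  χ (x == z) * χ (t ⊑ᵇ y ∷ w) + χ (z == y) * countWithPrefix t (insertions x w)
    ≡⟨ cong (λ n → χ (x == z) * χ (t ⊑ᵇ y ∷ w) + χ (z == y) * n) (countWithPrefix-insertions x w t) ⟩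
  χ (x == z) * χ (t ⊑ᵇ y ∷ w) + χ (z == y) * (k * χ (t ⊑ᵇ w) + D)
    ≡⟨ rearrange (χ (x == z) * χ (t ⊑ᵇ y ∷ w)) (χ (z == y)) k (χ (t ⊑ᵇ w)) D ⟩
  k * (χ (z == y) * χ (t ⊑ᵇ w)) + (χ (x == z) * χ (t ⊑ᵇ y ∷ w) + χ (z == y) * D)
    ≡⟨ sym (cong₂ (λ m n → k * m + (χ (x == z) * χ (t ⊑ᵇ y ∷ w) + n))
                  (χ-∧ (z == y) (t ⊑ᵇ w)) (∑-∷-⊑ᵇ-∷ z y (deletions x t) w)) ⟩
  k * χ (z ∷ t ⊑ᵇ y ∷ w) + (χ (x == z) * χ (t ⊑ᵇ y ∷ w) + ∑[ t′ ∈ map (z ∷_) (deletions x t) ] χ (t′ ⊑ᵇ y ∷ w))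
    ≡⟨ sym (cong (_+_ (k * χ (z ∷ t ⊑ᵇ y ∷ w))) (∑-if-∷ (x == z) t _ (λ t′ → χ (t′ ⊑ᵇ y ∷ w)))) ⟩
  k * χ (z ∷ t ⊑ᵇ y ∷ w) + ∑[ t′ ∈ deletions x (z ∷ t) ] χ (t′ ⊑ᵇ y ∷ w) ∎
  where
  k = suc (length w) ∸ length t
  D = ∑[ t′ ∈ deletions x t ] χ (t′ ⊑ᵇ w)
  rearrange : ∀ p e k q d → p + e * (k * q + d) ≡ k * (e * q) + (p + e * d)
  rearrange = solve-∀

countWithPrefix-perms-∷ : ∀ x xs t → countWithPrefix t (perms (x ∷ xs)) ≡
  (suc (length xs) ∸ length t) * countWithPrefix t (perms xs) + ∑[ t′ ∈ deletions x t ] countWithPrefix t′ (perms xs)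
countWithPrefix-perms-∷ x xs t = begin
  countWithPrefix t (concatMap (insertions x) (perms xs))
    ≡⟨ ∑-concatMap (insertions x) (perms xs) _ ⟩
  ∑[ w ∈ perms xs ] countWithPrefix t (insertions x w)
    ≡⟨ ∑-cong-All (All.map insertion-count (perms-lengths xs)) ⟩
  ∑[ w ∈ perms xs ] (k * χ (t ⊑ᵇ w) + ∑[ t′ ∈ deletions x t ] χ (t′ ⊑ᵇ w))
    ≡⟨ ∑-+ (perms xs) _ _ ⟩
  ∑[ w ∈ perms xs ] (k * χ (t ⊑ᵇ w)) + ∑[ w ∈ perms xs ] ∑[ t′ ∈ deletions x t ] χ (t′ ⊑ᵇ w)
    ≡⟨ cong₂ _+_ (∑-*ˡ k (perms xs) _) (∑-comm (deletions x t) (perms xs) (λ t′ w → χ (t′ ⊑ᵇ w))) ⟩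
  k * countWithPrefix t (perms xs) + ∑[ t′ ∈ deletions x t ] countWithPrefix t′ (perms xs) ∎
  where
  k = suc (length xs) ∸ length t
  insertion-count : ∀ {w} → length w ≡ length xs → countWithPrefix t (insertions x w) ≡
    k * χ (t ⊑ᵇ w) + ∑[ t′ ∈ deletions x t ] χ (t′ ⊑ᵇ w)
  insertion-count {w} eq rewrite sym eq = countWithPrefix-insertions x w t

-- The number of orderings of a deck of a + b labelled cards, a of one value and b of the other,
-- that begin with a fixed word containing c cards of the first value and d of the second.
arrangements : ℕ → ℕ → ℕ → ℕ → ℕ
arrangements a b c d = a ↓ c * b ↓ d * (a + b ∸ (c + d)) !

arrangements-comm : ∀ a b c d → arrangements a b c d ≡ arrangements b a d c
arrangements-comm a b c d =
  cong₂ (λ m n → m * n !) (*-comm (a ↓ c) (b ↓ d)) (cong₂ _∸_ (+-comm a b) (+-comm c d))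

arrangements-suc : ∀ a b c d →
  (suc (a + b) ∸ (c + d)) * arrangements a b c d + c * arrangements a b (c ∸ 1) d ≡ arrangements (suc a) b c d
arrangements-suc a b zero d with d ≤? a + b
... | yes d≤n = begin
  (suc n ∸ d) * (1 * b ↓ d * (n ∸ d) !) + 0
    ≡⟨ cong (λ k → k * (1 * b ↓ d * (n ∸ d) !) + 0) (+-∸-assoc 1 d≤n) ⟩
  suc (n ∸ d) * (1 * b ↓ d * (n ∸ d) !) + 0
    ≡⟨ rearrange (n ∸ d) (1 * b ↓ d) ((n ∸ d) !) ⟩
  1 * b ↓ d * suc (n ∸ d) !
    ≡⟨ cong (λ k → 1 * b ↓ d * k !) (sym (+-∸-assoc 1 d≤n)) ⟩
  1 * b ↓ d * (suc n ∸ d) ! ∎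
  where
  n = a + b
  rearrange : ∀ k x f → (1 + k) * (x * f) + 0 ≡ x * ((1 + k) * f)
  rearrange = solve-∀
... | no d≰n rewrite ↓-zero (≤-<-trans (m≤n+m b a) (≰⇒> d≰n)) =
  trans (+-identityʳ _) (*-zeroʳ (suc (a + b) ∸ d))
arrangements-suc a b (suc c) d with a + b ∸ (c + d) in eq
... | zero = begin
  0 + suc c * (a ↓ c * b ↓ d * 1)                   ≡⟨ cong (_+ suc c * (a ↓ c * b ↓ d * 1)) (sym a↓suc-c*b↓d≡0) ⟩
  a ↓ suc c * b ↓ d + suc c * (a ↓ c * b ↓ d * 1)   ≡⟨ rearrange (a ↓ suc c) (a ↓ c) (b ↓ d) c ⟩
  (a ↓ suc c + suc c * a ↓ c) * b ↓ d * 1           ≡⟨ cong (λ x → x * b ↓ d * 1) (sym (↓-pascal a c)) ⟩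
  suc a ↓ suc c * b ↓ d * 1                         ∎
  where
  a↓suc-c*b↓d≡0 : a ↓ suc c * b ↓ d ≡ 0
  a↓suc-c*b↓d≡0 = ↓*↓-zero {a} {b} {suc c} {d} (s≤s (m∸n≡0⇒m≤n eq))
  rearrange : ∀ p f y c → p * y + (1 + c) * (f * y * 1) ≡ (p + (1 + c) * f) * y * 1
  rearrange = solve-∀
... | suc r rewrite trans (sym (pred[m∸n]≡m∸[1+n] (a + b) (c + d))) (cong pred eq) = begin
  suc r * (a ↓ suc c * b ↓ d * r !) + suc c * (a ↓ c * b ↓ d * suc r !)
    ≡⟨ rearrange (a ↓ suc c) (a ↓ c) (b ↓ d) c r (r !) ⟩
  (a ↓ suc c + suc c * a ↓ c) * b ↓ d * suc r !
    ≡⟨ cong (λ x → x * b ↓ d * suc r !) (sym (↓-pascal a c)) ⟩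
  suc a ↓ suc c * b ↓ d * suc r ! ∎
  where
  rearrange : ∀ p f y c r g → (1 + r) * (p * y * g) + (1 + c) * (f * y * ((1 + r) * g)) ≡ (p + (1 + c) * f) * y * ((1 + r) * g)
  rearrange = solve-∀

*-suc-pred : ∀ c (h : ℕ → ℕ) → c * h (suc (c ∸ 1)) ≡ c * h c
*-suc-pred zero h = refl
*-suc-pred (suc c) h = refl

∑-deletions : ∀ x t (g : ℕ → ℕ → ℕ) →
  ∑[ t′ ∈ deletions x t ] g (count x t′) (count (other x) t′) ≡ count x t * g (count x t ∸ 1) (count (other x) t)
∑-deletions x [] g = refl
∑-deletions v1 (v1 ∷ t) g = cong (_+_ (g (count v1 t) (count v2 t))) (begin
  ∑[ t′ ∈ map (v1 ∷_) (deletions v1 t) ] g (count v1 t′) (count v2 t′)  ≡⟨ ∑-map (v1 ∷_) (deletions v1 t) _ ⟩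
  ∑[ t′ ∈ deletions v1 t ] g (suc (count v1 t′)) (count v2 t′)          ≡⟨ ∑-deletions v1 t (λ i j → g (suc i) j) ⟩
  count v1 t * g (suc (count v1 t ∸ 1)) (count v2 t)                    ≡⟨ *-suc-pred (count v1 t) (λ i → g i (count v2 t)) ⟩
  count v1 t * g (count v1 t) (count v2 t)                              ∎)
∑-deletions v1 (v2 ∷ t) g =
  trans (∑-map (v2 ∷_) (deletions v1 t) _) (∑-deletions v1 t (λ i j → g i (suc j)))
∑-deletions v2 (v1 ∷ t) g =
  trans (∑-map (v1 ∷_) (deletions v2 t) _) (∑-deletions v2 t (λ i j → g i (suc j)))
∑-deletions v2 (v2 ∷ t) g = cong (_+_ (g (count v2 t) (count v1 t))) (begin
  ∑[ t′ ∈ map (v2 ∷_) (deletions v2 t) ] g (count v2 t′) (count v1 t′)  ≡⟨ ∑-map (v2 ∷_) (deletions v2 t) _ ⟩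
  ∑[ t′ ∈ deletions v2 t ] g (suc (count v2 t′)) (count v1 t′)          ≡⟨ ∑-deletions v2 t (λ i j → g (suc i) j) ⟩
  count v2 t * g (suc (count v2 t ∸ 1)) (count v1 t)                    ≡⟨ *-suc-pred (count v2 t) (λ i → g i (count v1 t)) ⟩
  count v2 t * g (count v2 t) (count v1 t)                              ∎)

arrangementsFor : Val → List Val → List Val → ℕ
arrangementsFor x L t = arrangements (count x L) (count (other x) L) (count x t) (count (other x) t)

arrangementsFor-v1 : ∀ x L t → arrangementsFor x L t ≡ arrangementsFor v1 L t
arrangementsFor-v1 v1 L t = refl
arrangementsFor-v1 v2 L t = arrangements-comm (count v2 L) (count v1 L) (count v2 t) (count v1 t)

countWithPrefix-perms : ∀ L t → countWithPrefix t (perms L) ≡ arrangementsFor v1 L t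
countWithPrefix-perms [] [] = refl
countWithPrefix-perms [] (v1 ∷ t) = refl
countWithPrefix-perms [] (v2 ∷ t) = sym (cong (_* (0 ∸ (count v1 t + suc (count v2 t))) !) (*-zeroʳ (0 ↓ count v1 t)))
countWithPrefix-perms (x ∷ xs) t = begin
  countWithPrefix t (perms (x ∷ xs))
    ≡⟨ countWithPrefix-perms-∷ x xs t ⟩
  (suc (length xs) ∸ length t) * countWithPrefix t (perms xs) + ∑[ t′ ∈ deletions x t ] countWithPrefix t′ (perms xs)
    ≡⟨ cong₂ _+_ (cong₂ (λ n k → (suc n ∸ length t) * k) (sym (count+count-other x xs)) (closed-form t))
                 (∑-cong (deletions x t) closed-form) ⟩
  (suc (a + b) ∸ length t) * arrangements a b c d
    + ∑[ t′ ∈ deletions x t ] arrangements a b (count x t′) (count (other x) t′)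
    ≡⟨ cong₂ (λ n k → (suc (a + b) ∸ n) * arrangements a b c d + k)
             (sym (count+count-other x t)) (∑-deletions x t (arrangements a b)) ⟩
  (suc (a + b) ∸ (c + d)) * arrangements a b c d + c * arrangements a b (c ∸ 1) d
    ≡⟨ arrangements-suc a b c d ⟩
  arrangements (suc a) b c d
    ≡⟨ sym (cong₂ (λ a′ b′ → arrangements a′ b′ c d) (count-∷-self x xs) (count-∷-other x xs)) ⟩
  arrangementsFor x (x ∷ xs) t
    ≡⟨ arrangementsFor-v1 x (x ∷ xs) t ⟩
  arrangementsFor v1 (x ∷ xs) t ∎
  where
  a = count x xs
  b = count (other x) xs
  c = count x t
  d = count (other x) t
  closed-form : ∀ t′ → countWithPrefix t′ (perms xs) ≡ arrangementsFor x xs t′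
  closed-form t′ = trans (countWithPrefix-perms xs t′) (sym (arrangementsFor-v1 x xs t′))

-- The winning probability

winsFrom-⊑ᵇ : ∀ σ hist k w → k ≤ length w → winsFrom σ hist k w ≡ (map other (bidsFrom σ hist k) ⊑ᵇ w)
winsFrom-⊑ᵇ σ hist zero w _ = refl
winsFrom-⊑ᵇ σ hist (suc k) (c ∷ w) (s≤s k≤|w|) with σ hist
winsFrom-⊑ᵇ σ hist (suc k) (v1 ∷ w) (s≤s k≤|w|) | v1 = refl
winsFrom-⊑ᵇ σ hist (suc k) (v2 ∷ w) (s≤s k≤|w|) | v1 = winsFrom-⊑ᵇ σ (hist ++ [ v2 ]) k w k≤|w|
winsFrom-⊑ᵇ σ hist (suc k) (v1 ∷ w) (s≤s k≤|w|) | v2 = winsFrom-⊑ᵇ σ (hist ++ [ v1 ]) k w k≤|w|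
winsFrom-⊑ᵇ σ hist (suc k) (v2 ∷ w) (s≤s k≤|w|) | v2 = refl

length-deck : ∀ s1 s2 → length (deck s1 s2) ≡ s1 + s2
length-deck s1 s2 = trans (length-++ (replicate s1 v1)) (cong₂ _+_ (length-replicate s1) (length-replicate s2))

count-v1-deck : ∀ s1 s2 → count v1 (deck s1 s2) ≡ s1
count-v1-deck s1 s2 = begin
  count v1 (replicate s1 v1 ++ replicate s2 v2)            ≡⟨ count-++ v1 (replicate s1 v1) (replicate s2 v2) ⟩
  count v1 (replicate s1 v1) + count v1 (replicate s2 v2)  ≡⟨ cong₂ _+_ (count-replicate v1 s1) (count-other-replicate v2 s2) ⟩
  s1 + 0                                                   ≡⟨ +-identityʳ s1 ⟩
  s1                                                       ∎

count-v2-deck : ∀ s1 s2 → count v2 (deck s1 s2) ≡ s2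
count-v2-deck s1 s2 = begin
  count v2 (replicate s1 v1 ++ replicate s2 v2)            ≡⟨ count-++ v2 (replicate s1 v1) (replicate s2 v2) ⟩
  count v2 (replicate s1 v1) + count v2 (replicate s2 v2)  ≡⟨ cong₂ _+_ (count-other-replicate v1 s1) (count-replicate v2 s2) ⟩
  s2                                                       ∎

winCount-arrangements : ∀ s1 s2 m σ → m ≤ s1 + s2 →
  winCount s1 s2 m σ ≡ arrangements s1 s2 (count v2 (bids σ m)) (count v1 (bids σ m))
winCount-arrangements s1 s2 m σ m≤n = begin
  ∑[ w ∈ perms (deck s1 s2) ] χ (winsFrom σ [] m w)
    ≡⟨ ∑-cong-All (All.map wins⇔prefix (perms-lengths (deck s1 s2))) ⟩
  countWithPrefix (map other (bids σ m)) (perms (deck s1 s2))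
    ≡⟨ countWithPrefix-perms (deck s1 s2) (map other (bids σ m)) ⟩
  arrangementsFor v1 (deck s1 s2) (map other (bids σ m))
    ≡⟨ cong₂ (λ a b → arrangements a b (count v1 (map other (bids σ m))) (count v2 (map other (bids σ m))))
             (count-v1-deck s1 s2) (count-v2-deck s1 s2) ⟩
  arrangements s1 s2 (count v1 (map other (bids σ m))) (count v2 (map other (bids σ m)))
    ≡⟨ cong₂ (arrangements s1 s2) (count-map-other v1 (bids σ m)) (count-map-other v2 (bids σ m)) ⟩
  arrangements s1 s2 (count v2 (bids σ m)) (count v1 (bids σ m)) ∎
  where
  wins⇔prefix : ∀ {w} → length w ≡ length (deck s1 s2) → χ (winsFrom σ [] m w) ≡ χ (map other (bids σ m) ⊑ᵇ w)
  wins⇔prefix eq = cong χ (winsFrom-⊑ᵇ σ [] m _ (≤-trans m≤n (≤-reflexive (sym (trans eq (length-deck s1 s2))))))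

totalCount-! : ∀ s1 s2 → totalCount s1 s2 ≡ (s1 + s2) !
totalCount-! s1 s2 = begin
  countWithPrefix [] (perms (deck s1 s2))          ≡⟨ countWithPrefix-perms (deck s1 s2) [] ⟩
  arrangementsFor v1 (deck s1 s2) []               ≡⟨ cong₂ (λ a b → arrangements a b 0 0) (count-v1-deck s1 s2) (count-v2-deck s1 s2) ⟩
  1 * 1 * (s1 + s2) !                              ≡⟨ *-identityˡ ((s1 + s2) !) ⟩
  (s1 + s2) !                                      ∎

C-*-!-! : ∀ k l → ((k + l) C k) * (k ! * l !) ≡ (k + l) !
C-*-!-! k l = begin
  ((k + l) C k) * (k ! * l !)              ≡⟨ cong (λ j → ((k + l) C k) * (k ! * j !)) (sym (m+n∸m≡n k l)) ⟩
  ((k + l) C k) * (k ! * (k + l ∸ k) !)    ≡⟨ cong (_* (k ! * (k + l ∸ k) !)) (nCk≡n!/k![n-k]! k≤k+l) ⟩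
  (k + l) ! / (k ! * (k + l ∸ k) !) * (k ! * (k + l ∸ k) !) ≡⟨ m/n*n≡m (k![n∸k]!∣n! k≤k+l) ⟩
  (k + l) !                              ∎
  where
  k≤k+l = m≤m+n k l
  instance _ = k !* (k + l ∸ k) !≢0

C-pos : ∀ k l → 0 < (k + l) C k
C-pos k l = n≢0⇒n>0 λ C≡0 → n>0⇒n≢0 (1≤n! (k + l)) (trans (sym (C-*-!-! k l)) (cong (_* (k ! * l !)) C≡0))

binomℤ-⊖-< : ∀ n {a b} → a < b → binomℤ n (a ⊖ b) ≡ 0
binomℤ-⊖-< n {zero} {suc b} _ = refl
binomℤ-⊖-< n {suc a} {suc b} (s≤s a<b) rewrite ℤₚ.[1+m]⊖[1+n]≡m⊖n a b = binomℤ-⊖-< n a<b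

↓*↓*!-binomial : ∀ i p r q → (i + p) ↓ i * (r + q) ↓ r * (p + q) ! * ((i + p + (r + q)) C (i + p))
                             ≡ ((p + q) C p) * (i + p + (r + q)) !
↓*↓*!-binomial i p r q = *-cancelʳ-≡ _ _ (p ! * q !) {{p !* q !≢0}} (begin
  (i + p) ↓ i * (r + q) ↓ r * (p + q) ! * K * (p ! * q !)
    ≡⟨ rearrange₁ ((i + p) ↓ i) ((r + q) ↓ r) ((p + q) !) K (p !) (q !) ⟩
  (i + p) ↓ i * p ! * ((r + q) ↓ r * q !) * ((p + q) ! * K)
    ≡⟨ cong₂ (λ x y → x * y * ((p + q) ! * K)) (↓-*-! i p) (↓-*-! r q) ⟩
  (i + p) ! * (r + q) ! * ((p + q) ! * K)
    ≡⟨ rearrange₂ ((i + p) !) ((r + q) !) ((p + q) !) K ⟩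
  (p + q) ! * (K * ((i + p) ! * (r + q) !))
    ≡⟨ cong ((p + q) ! *_) (C-*-!-! (i + p) (r + q)) ⟩
  (p + q) ! * N !
    ≡⟨ cong (_* N !) (sym (C-*-!-! p q)) ⟩
  ((p + q) C p) * (p ! * q !) * N !
    ≡⟨ rearrange₃ ((p + q) C p) (p ! * q !) (N !) ⟩
  ((p + q) C p) * N ! * (p ! * q !) ∎)
  where
  N = i + p + (r + q)
  K = N C (i + p)
  rearrange₁ : ∀ a b c d x y → a * b * c * d * (x * y) ≡ a * x * (b * y) * (c * d)
  rearrange₁ = solve-∀
  rearrange₂ : ∀ a b c d → a * b * (c * d) ≡ c * (d * (a * b))
  rearrange₂ = solve-∀
  rearrange₃ : ∀ a b c → a * b * c ≡ a * c * b
  rearrange₃ = solve-∀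

[m+n+o]∸[m+p]≡n+o∸p : ∀ m n o p → m + n + o ∸ (m + p) ≡ n + o ∸ p
[m+n+o]∸[m+p]≡n+o∸p m n o p = trans (cong (_∸ (m + p)) (+-assoc m n o)) ([m+n]∸[m+o]≡n∸o m (n + o) p)

m+[n+o]∸n≡m+o : ∀ m n o → m + (n + o) ∸ n ≡ m + o
m+[n+o]∸n≡m+o m n o = trans (+-∸-assoc m (m≤m+n n o)) (cong (_+_ m) (m+n∸m≡n n o))

m+n∸o<m : ∀ {m n o} → n < o → o ≤ m + n → m + n ∸ o < m
m+n∸o<m {m} {n} n<o o≤m+n = ≤-trans (∸-monoʳ-< n<o o≤m+n) (≤-reflexive (m+n∸n≡m m n))

arrangements-binomial-+ : ∀ i p s2 r → i + r ≤ i + p + s2 →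
  arrangements (i + p) s2 i r * ((i + p + s2) C (i + p)) ≡ ((i + p + s2 ∸ (i + r)) C p) * (i + p + s2) !
arrangements-binomial-+ i p s2 r i+r≤n rewrite [m+n+o]∸[m+p]≡n+o∸p i p s2 r with r ≤? s2
... | no r≰s2 rewrite ↓-zero (≰⇒> r≰s2) | *-zeroʳ ((i + p) ↓ i)
                    | k>n⇒nCk≡0 (m+n∸o<m (≰⇒> r≰s2) (+-cancelˡ-≤ i r (p + s2) (subst (i + r ≤_) (+-assoc i p s2) i+r≤n))) = refl
... | yes r≤s2 with m≤n⇒∃[o]m+o≡n r≤s2
...   | q , refl rewrite m+[n+o]∸n≡m+o p r q = ↓*↓*!-binomial i p r q

arrangements-binomial : ∀ s1 s2 i r → i + r ≤ s1 + s2 →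
  arrangements s1 s2 i r * ((s1 + s2) C s1) ≡ binomℤ (s1 + s2 ∸ (i + r)) (+ s1 -ℤ + i) * (s1 + s2) !
arrangements-binomial s1 s2 i r i+r≤n rewrite ℤₚ.m-n≡m⊖n s1 i with i ≤? s1
... | no i≰s1 rewrite ↓-zero (≰⇒> i≰s1) | binomℤ-⊖-< (s1 + s2 ∸ (i + r)) (≰⇒> i≰s1) = refl
... | yes i≤s1 with m≤n⇒∃[o]m+o≡n i≤s1
...   | p , refl rewrite ℤₚ.⊖-≥ (m≤m+n i p) | m+n∸m≡n i p = arrangements-binomial-+ i p s2 r i+r≤n

arrangements-pos⇔ : ∀ a b c d → 0 < arrangements a b c d ⇔ (c ≤ a × d ≤ b)
arrangements-pos⇔ a b c d = mk⇔
  (λ pos → ≮⇒≥ (λ a<c → n>0⇒n≢0 pos (cong (λ x → x * b ↓ d * k !) (↓-zero a<c))) ,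
           ≮⇒≥ (λ b<d → n>0⇒n≢0 pos (trans (cong (λ x → a ↓ c * x * k !) (↓-zero b<d)) (cong (_* k !) (*-zeroʳ (a ↓ c))))))
  (λ (c≤a , d≤b) → *-mono-< (*-mono-< (↓-pos c≤a) (↓-pos d≤b)) (1≤n! k))
  where k = a + b ∸ (c + d)

toℚᵘ-frac : ∀ a d → toℚᵘ (frac a (suc d)) ℚᵘ.≃ ℚᵘ.mkℚᵘ (+ a) d
toℚᵘ-frac a d = ℚ.toℚᵘ-fromℚᵘ (ℚᵘ.mkℚᵘ (+ a) d)

frac-cross : ∀ {a b x y} → 0 < x → 0 < y → a * y ≡ b * x → frac a x ≡ frac b y
frac-cross {a} {b} {suc d} {suc e} _ _ eq =
  ℚ.fromℚᵘ-cong {ℚᵘ.mkℚᵘ (+ a) d} {ℚᵘ.mkℚᵘ (+ b) e} (ℚᵘ.*≡* (trans (sym (ℤₚ.pos-* a (suc e))) (trans (cong +_ eq) (ℤₚ.pos-* b (suc d)))))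

frac-0 : ∀ x → frac 0 x ≡ 0ℚ
frac-0 zero = refl
frac-0 (suc d) = frac-cross {0} {0} {suc d} {1} z<s z<s refl

frac≡0⇒≡0 : ∀ {a x} → 0 < x → frac a x ≡ 0ℚ → a ≡ 0
frac≡0⇒≡0 {a} {suc d} _ eq with ℚ.fromℚᵘ-injective {ℚᵘ.mkℚᵘ (+ a) d} {ℚᵘ.mkℚᵘ (+ 0) 0} eq
... | ℚᵘ.*≡* eq′ = trans (sym (*-identityʳ a)) (ℤₚ.+-injective (trans (ℤₚ.pos-* a 1) eq′))

frac≢0⇔pos : ∀ {a x} → 0 < x → (¬ (frac a x ≡ 0ℚ)) ⇔ (0 < a)
frac≢0⇔pos {a} {x} 0<x = mk⇔ (λ ≢0 → n≢0⇒n>0 (λ a≡0 → ≢0 (trans (cong (λ n → frac n x) a≡0) (frac-0 x))))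
                               (λ 0<a eq → n>0⇒n≢0 0<a (frac≡0⇒≡0 0<x eq))

frac-mono-≤ : ∀ {a b x} → a ≤ b → frac a x ≤ℚ frac b x
frac-mono-≤ {x = zero} _ = ℚ.≤-refl
frac-mono-≤ {a} {b} {suc d} a≤b = ℚ.toℚᵘ-cancel-≤
  (ℚᵘ.≤-respʳ-≃ (ℚᵘ.≃-sym (toℚᵘ-frac b d)) (ℚᵘ.≤-respˡ-≃ (ℚᵘ.≃-sym (toℚᵘ-frac a d))
    (ℚᵘ.*≤* (subst₂ ℤ._≤_ (ℤₚ.pos-* a (suc d)) (ℤₚ.pos-* b (suc d)) (ℤ.+≤+ (*-monoˡ-≤ (suc d) a≤b))))))

frac-cancel-≤ : ∀ {a b x} → 0 < x → frac a x ≤ℚ frac b x → a ≤ b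
frac-cancel-≤ {a} {b} {suc d} _ le with ℚᵘ.≤-respʳ-≃ (toℚᵘ-frac b d) (ℚᵘ.≤-respˡ-≃ (toℚᵘ-frac a d) (ℚ.toℚᵘ-mono-≤ le))
... | ℚᵘ.*≤* le′ = *-cancelʳ-≤ a b (suc d) (ℤₚ.drop‿+≤+ (subst₂ ℤ._≤_ (sym (ℤₚ.pos-* a (suc d))) (sym (ℤₚ.pos-* b (suc d))) le′))

-- Maximising a ↓ i * b ↓ r along the line i + r = constant

∸-exchange : ∀ {a b i r} → b + i ≤ a + r → b ∸ r ≤ a ∸ i
∸-exchange {a} {b} {i} {r} b+i≤a+r =
  subst₂ _≤_ ([m+n]∸[m+o]≡n∸o i b r) (trans (cong₂ _∸_ (+-comm a r) (+-comm i r)) ([m+n]∸[m+o]≡n∸o r a i))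
    (∸-monoˡ-≤ (i + r) (subst (_≤ a + r) (+-comm b i) b+i≤a+r))

↓-exchange-≤ : ∀ a b i r → b + i ≤ a + r → a ↓ i * b ↓ suc r ≤ a ↓ suc i * b ↓ r
↓-exchange-≤ a b i r b+i≤a+r rewrite ↓*↓-sucʳ a b i r | ↓*↓-sucˡ a b i r =
  *-monoˡ-≤ (a ↓ i * b ↓ r) (∸-exchange {a} {b} {i} {r} b+i≤a+r)

↓-exchange-< : ∀ a b i r → suc (b + i) ≤ a + r → 0 < a ↓ i * b ↓ suc r → a ↓ i * b ↓ suc r < a ↓ suc i * b ↓ r
↓-exchange-< a b i r b+i<a+r pos rewrite ↓*↓-sucʳ a b i r | ↓*↓-sucˡ a b i r =
  *-monoˡ-< (a ↓ i * b ↓ r) {{m*n≢0⇒n≢0 (b ∸ r) {{>-nonZero pos}}}} b∸r<a∸i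
  where
  r<b : r < b
  r<b = m∸n≢0⇒n<m (≢-nonZero⁻¹ (b ∸ r) {{m*n≢0⇒m≢0 (b ∸ r) {{>-nonZero pos}}}})
  b∸r<a∸i : b ∸ r < a ∸ i
  b∸r<a∸i = subst (_≤ a ∸ i) (+-∸-assoc 1 (<⇒≤ r<b)) (∸-exchange {a} {suc b} {i} {r} b+i<a+r)

↓*↓-climb : ∀ a b i r k → b + i + k ≤ suc (a + r) → a ↓ i * b ↓ (k + r) ≤ a ↓ (i + k) * b ↓ r
↓*↓-climb a b i r zero _ = ≤-reflexive (cong (λ j → a ↓ j * b ↓ r) (sym (+-identityʳ i)))
↓*↓-climb a b i r (suc k) b+i+k<a+r+1 rewrite sym (+-suc k r) | +-suc i k =
  ≤-trans (↓*↓-climb a b i (suc r) k (m≤n⇒m≤1+n (≤-trans b+i+k≤a+r (+-monoʳ-≤ a (n≤1+n r)))))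
          (↓-exchange-≤ a b (i + k) r (subst (_≤ a + r) (+-assoc b i k) b+i+k≤a+r))
  where
  b+i+k≤a+r : b + i + k ≤ a + r
  b+i+k≤a+r = s≤s⁻¹ (subst (_≤ suc (a + r)) (+-suc (b + i) k) b+i+k<a+r+1)

-- ∣ (a − i) − (b − r) ∣ ≤ 1, stated without subtraction.
Balanced : ℕ → ℕ → ℕ → ℕ → Set
Balanced a b i r = a + r ≤ suc (b + i) × b + i ≤ suc (a + r)

balanced? : ∀ a b i r → Dec (Balanced a b i r)
balanced? a b i r = (a + r ≤? suc (b + i)) ×-dec (b + i ≤? suc (a + r))

Maximal : ℕ → ℕ → ℕ → ℕ → Set
Maximal a b j q = ∀ i r → i + r ≡ j + q → a ↓ i * b ↓ r ≤ a ↓ j * b ↓ q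

balanced-maximal-≤ : ∀ a b {i r j q} → Balanced a b j q → i ≤ j → i + r ≡ j + q → a ↓ i * b ↓ r ≤ a ↓ j * b ↓ q
balanced-maximal-≤ a b {i} {r} {q = q} (_ , b+j≤a+q+1) i≤j i+r≡j+q with m≤n⇒∃[o]m+o≡n i≤j
... | k , refl = subst (λ x → a ↓ i * b ↓ x ≤ a ↓ (i + k) * b ↓ q) k+q≡r
                   (↓*↓-climb a b i q k (subst (_≤ suc (a + q)) (sym (+-assoc b i k)) b+j≤a+q+1))
  where
  k+q≡r : k + q ≡ r
  k+q≡r = +-cancelˡ-≡ i (k + q) r (trans (sym (+-assoc i k q)) (sym i+r≡j+q))

balanced-maximal : ∀ a b {j q} → Balanced a b j q → Maximal a b j q
balanced-maximal a b {j} {q} (a+q≤b+j+1 , b+j≤a+q+1) i r i+r≡j+q with ≤-total i j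
... | inj₁ i≤j = balanced-maximal-≤ a b (a+q≤b+j+1 , b+j≤a+q+1) i≤j i+r≡j+q
... | inj₂ j≤i = subst₂ _≤_ (*-comm (b ↓ r) (a ↓ i)) (*-comm (b ↓ q) (a ↓ j))
                   (balanced-maximal-≤ b a (b+j≤a+q+1 , a+q≤b+j+1) r≤q (trans (+-comm r i) (trans i+r≡j+q (+-comm j q))))
  where
  r≤q : r ≤ q
  r≤q = +-cancelˡ-≤ j r q (≤-trans (+-monoˡ-≤ r j≤i) (≤-reflexive i+r≡j+q))

Improvable : ℕ → ℕ → ℕ → ℕ → Set
Improvable a b i r = ∃₂ λ i′ r′ → i′ + r′ ≡ i + r × a ↓ i * b ↓ r < a ↓ i′ * b ↓ r′

improvable-swap : ∀ a b i r → Improvable b a r i → Improvable a b i r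
improvable-swap a b i r (r′ , i′ , r′+i′≡r+i , lt) =
  i′ , r′ , trans (+-comm i′ r′) (trans r′+i′≡r+i (+-comm r i)) ,
  subst₂ _<_ (*-comm (b ↓ r) (a ↓ i)) (*-comm (b ↓ r′) (a ↓ i′)) lt

feasible-split : ∀ a b {m} → m ≤ a + b → ∃₂ λ i r → i + r ≡ m × 0 < a ↓ i * b ↓ r
feasible-split a b {m} m≤a+b with m ≤? a
... | yes m≤a = m , 0 , +-identityʳ m , *-mono-< (↓-pos m≤a) (z<s {0})
... | no m≰a = a , m ∸ a , m+[n∸m]≡n (<⇒≤ (≰⇒> m≰a)) , *-mono-< (↓-pos (≤-refl {a})) (↓-pos (m≤n+o⇒m∸n≤o m a m≤a+b))

improvable-zero : ∀ a b {i r} → i + r ≤ a + b → a ↓ i * b ↓ r ≡ 0 → Improvable a b i r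
improvable-zero a b i+r≤a+b ≡0 with feasible-split a b i+r≤a+b
... | i′ , r′ , i′+r′≡i+r , pos = i′ , r′ , i′+r′≡i+r , subst (_< a ↓ i′ * b ↓ r′) (sym ≡0) pos

improvable-step : ∀ a b i r → suc (b + i) ≤ a + r → i + suc r ≤ a + b → Improvable a b i (suc r)
improvable-step a b i r b+i<a+r i+r+1≤a+b with a ↓ i * b ↓ suc r ≟ 0
... | yes ≡0 = improvable-zero a b {i} {suc r} i+r+1≤a+b ≡0
... | no ≢0 = suc i , r , sym (+-suc i r) , ↓-exchange-< a b i r b+i<a+r (n≢0⇒n>0 ≢0)

improvable-by-raising : ∀ a b i r → suc (suc (b + i)) ≤ a + r → a ≤ suc (b + (i + r)) → i + r ≤ a + b →
  Improvable a b i r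
improvable-by-raising a b i zero b+i+2≤a a≤b+i+1 _ =
  contradiction (≤-trans (subst (_ ≤_) (+-identityʳ a) b+i+2≤a) (subst (λ x → a ≤ suc (b + x)) (+-identityʳ i) a≤b+i+1))
                (1+n≰n {suc (b + i)})
improvable-by-raising a b i (suc r) b+i+2≤a+r+1 _ i+r+1≤a+b =
  improvable-step a b i r (s≤s⁻¹ (subst (suc (suc (b + i)) ≤_) (+-suc a r) b+i+2≤a+r+1)) i+r+1≤a+b

unbalanced-improvable : ∀ a b i r → a ≤ suc (b + (i + r)) → b ≤ suc (a + (i + r)) → i + r ≤ a + b →
  ¬ Balanced a b i r → Improvable a b i r
unbalanced-improvable a b i r a≤ b≤ i+r≤a+b unbalanced with a + r ≤? suc (b + i) | b + i ≤? suc (a + r)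
... | yes p | yes q = contradiction (p , q) unbalanced
... | no ¬p | _ = improvable-by-raising a b i r (≰⇒> ¬p) a≤ i+r≤a+b
... | yes _ | no ¬q = improvable-swap a b i r
  (improvable-by-raising b a r i (≰⇒> ¬q) (subst (λ x → b ≤ suc (a + x)) (+-comm i r) b≤)
                                          (subst₂ _≤_ (+-comm i r) (+-comm a b) i+r≤a+b))

maximal⇒balanced : ∀ a b {j q} → a ≤ suc (b + (j + q)) → b ≤ suc (a + (j + q)) → j + q ≤ a + b →
  Maximal a b j q → Balanced a b j q
maximal⇒balanced a b {j} {q} a≤ b≤ j+q≤a+b maximal with balanced? a b j q
... | yes balanced = balanced
... | no unbalanced with unbalanced-improvable a b j q a≤ b≤ j+q≤a+b unbalanced
...   | i , r , i+r≡j+q , lt = contradiction (maximal i r i+r≡j+q) (<⇒≱ lt)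

maximal⇔balanced : ∀ a b {j q} → a ≤ suc (b + (j + q)) → b ≤ suc (a + (j + q)) → j + q ≤ a + b →
  Maximal a b j q ⇔ Balanced a b j q
maximal⇔balanced a b a≤ b≤ j+q≤a+b = mk⇔ (maximal⇒balanced a b a≤ b≤ j+q≤a+b) (balanced-maximal a b)

right-end-maximal : ∀ a b j → b + j ≤ a → Maximal a b j 0
right-end-maximal a b j b+j≤a i r i+r≡j+0 =
  subst₂ (λ x y → a ↓ i * b ↓ x ≤ a ↓ y * b ↓ 0) (+-identityʳ r) i+r≡j
    (↓*↓-climb a b i 0 r (m≤n⇒m≤1+n (subst₂ _≤_ b+j≡b+i+r (sym (+-identityʳ a)) b+j≤a)))
  where
  i+r≡j : i + r ≡ j
  i+r≡j = trans i+r≡j+0 (+-identityʳ j)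
  b+j≡b+i+r : b + j ≡ b + i + r
  b+j≡b+i+r = trans (cong (_+_ b) (sym i+r≡j)) (sym (+-assoc b i r))

maximal⇒q≡0 : ∀ a b j q → b + (j + q) ≤ a → Maximal a b j q → q ≡ 0
maximal⇒q≡0 a b j zero _ _ = refl
maximal⇒q≡0 a b j (suc q) b+j+q+1≤a maximal with improvable-step a b j q b+j<a+q j+q+1≤a+b
  where
  b+j<a+q : suc (b + j) ≤ a + q
  b+j<a+q = ≤-trans (+-monoʳ-< b (m<m+n j (z<s {q}))) (≤-trans b+j+q+1≤a (m≤m+n a q))
  j+q+1≤a+b : j + suc q ≤ a + b
  j+q+1≤a+b = ≤-trans (m≤n+m (j + suc q) b) (≤-trans b+j+q+1≤a (m≤m+n a b))
... | i , r , i+r≡j+q , lt = contradiction (maximal i r i+r≡j+q) (<⇒≱ lt)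

maximal⇔q≡0 : ∀ a b j q → b + (j + q) ≤ a → Maximal a b j q ⇔ q ≡ 0
maximal⇔q≡0 a b j q b+j+q≤a = mk⇔ (maximal⇒q≡0 a b j q b+j+q≤a) λ { refl →
  right-end-maximal a b j (subst (λ x → b + x ≤ a) (+-identityʳ j) b+j+q≤a) }

-- Optimal strategies

∸≤1⇔≤suc : ∀ x y → y ∸ x ≤ 1 ⇔ y ≤ suc x
∸≤1⇔≤suc x y = mk⇔
  (λ y∸x≤1 → ≤-trans (m≤n+m∸n y x) (subst (x + (y ∸ x) ≤_) (+-comm x 1) (+-monoʳ-≤ x y∸x≤1)))
  (λ y≤1+x → m≤n+o⇒m∸n≤o y x (subst (y ≤_) (+-comm 1 x) y≤1+x))

∣⊖∣≤1⇔ : ∀ x y → ∣ x ⊖ y ∣ ≤ 1 ⇔ (x ≤ suc y × y ≤ suc x)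
∣⊖∣≤1⇔ x y with ≤-total x y
... | inj₁ x≤y rewrite ℤₚ.∣⊖∣-≤ x≤y =
  mk⇔ (λ h → m≤n⇒m≤1+n x≤y , Equivalence.to (∸≤1⇔≤suc x y) h) (λ (_ , h) → Equivalence.from (∸≤1⇔≤suc x y) h)
... | inj₂ y≤x rewrite ℤₚ.⊖-≥ y≤x =
  mk⇔ (λ h → Equivalence.to (∸≤1⇔≤suc y x) h , m≤n⇒m≤1+n y≤x) (λ (h , _) → Equivalence.from (∸≤1⇔≤suc y x) h)

[a-i]-[b-r]≡[a+r]-[b+i] : ∀ a i b r → (a -ℤ i) -ℤ (b -ℤ r) ≡ (a ℤ.+ r) -ℤ (b ℤ.+ i)
[a-i]-[b-r]≡[a+r]-[b+i] = ℤ-Solver.solve-∀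

∣[a-i]-[b-r]∣≤1⇔balanced : ∀ a b i r → ∣ (+ a -ℤ + i) -ℤ (+ b -ℤ + r) ∣ ≤ 1 ⇔ Balanced a b i r
∣[a-i]-[b-r]∣≤1⇔balanced a b i r
  rewrite [a-i]-[b-r]≡[a+r]-[b+i] (+ a) (+ i) (+ b) (+ r) | ℤₚ.m-n≡m⊖n (a + r) (b + i) = ∣⊖∣≤1⇔ (a + r) (b + i)

length-bidsFrom : ∀ σ hist k → length (bidsFrom σ hist k) ≡ k
length-bidsFrom σ hist zero = refl
length-bidsFrom σ hist (suc k) = cong suc (length-bidsFrom σ _ k)

count-bids : ∀ σ m → count v2 (bids σ m) + count v1 (bids σ m) ≡ m
count-bids σ m = trans (count+count-other v2 (bids σ m)) (length-bidsFrom σ [] m)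

switching : ℕ → Strategy
switching i hist = if length hist <ᵇ i then v2 else v1

length-snoc : ∀ (hist : List Val) x → length (hist ++ [ x ]) ≡ suc (length hist)
length-snoc hist x = trans (length-++ hist) (+-comm (length hist) 1)

count-v2-switching : ∀ i k hist → count v2 (bidsFrom (switching i) hist k) ≡ (i ∸ length hist) ⊓ k
count-v2-switching i zero hist = sym (⊓-zeroʳ (i ∸ length hist))
count-v2-switching i (suc k) hist with length hist <ᵇ i in eq
... | true rewrite count-v2-switching i k (hist ++ [ v1 ]) | length-snoc hist v1
                 | +-∸-assoc 1 (<ᵇ⇒< (length hist) i (subst T (sym eq) tt)) = refl
... | false = begin
  count v2 (bidsFrom (switching i) (hist ++ [ v2 ]) k)  ≡⟨ count-v2-switching i k (hist ++ [ v2 ]) ⟩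
  (i ∸ length (hist ++ [ v2 ])) ⊓ k                    ≡⟨ cong (λ j → (i ∸ j) ⊓ k) (length-snoc hist v2) ⟩
  (i ∸ suc (length hist)) ⊓ k                          ≡⟨ cong (_⊓ k) (m≤n⇒m∸n≡0 (m≤n⇒m≤1+n i≤h)) ⟩
  0                                                    ≡⟨ cong (_⊓ suc k) (sym (m≤n⇒m∸n≡0 i≤h)) ⟩
  (i ∸ length hist) ⊓ suc k                            ∎
  where
  i≤h : i ≤ length hist
  i≤h = ≮⇒≥ (λ h<i → subst T eq (<⇒<ᵇ h<i))

bids-realizable : ∀ {i r m} → i + r ≡ m → Σ Strategy λ τ → count v2 (bids τ m) ≡ i × count v1 (bids τ m) ≡ r
bids-realizable {i} {r} {m} i+r≡m = switching i , b2≡i , +-cancelˡ-≡ i b1 r (begin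
  i + b1   ≡⟨ cong (_+ b1) (sym b2≡i) ⟩
  count v2 (bids (switching i) m) + b1 ≡⟨ count-bids (switching i) m ⟩
  m        ≡⟨ sym i+r≡m ⟩
  i + r    ∎)
  where
  b1 = count v1 (bids (switching i) m)
  b2≡i : count v2 (bids (switching i) m) ≡ i
  b2≡i = trans (count-v2-switching i m []) (m≤n⇒m⊓n≡m (subst (i ≤_) i+r≡m (m≤m+n i r)))

count-v1≡0⇔All-v2 : ∀ l → count v1 l ≡ 0 ⇔ All (_≡ v2) l
count-v1≡0⇔All-v2 l = mk⇔ (to l) (from l)
  where
  to : ∀ l → count v1 l ≡ 0 → All (_≡ v2) l
  to [] _ = []
  to (v2 ∷ l) eq = refl ∷ to l eq
  from : ∀ l → All (_≡ v2) l → count v1 l ≡ 0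
  from [] [] = refl
  from (_ ∷ l) (refl ∷ all) = from l all

winProb-arrangements : ∀ s1 s2 m σ → m ≤ s1 + s2 →
  winProb s1 s2 m σ ≡ frac (arrangements s1 s2 (count v2 (bids σ m)) (count v1 (bids σ m))) ((s1 + s2) !)
winProb-arrangements s1 s2 m σ m≤n = cong₂ frac (winCount-arrangements s1 s2 m σ m≤n) (totalCount-! s1 s2)

Optimal : ℕ → ℕ → ℕ → Strategy → Set
Optimal s1 s2 m σ = (τ : Strategy) → winProb s1 s2 m τ ≤ℚ winProb s1 s2 m σ

optimal⇔maximal : ∀ s1 s2 m σ → m ≤ s1 + s2 →
  Optimal s1 s2 m σ ⇔ Maximal s1 s2 (count v2 (bids σ m)) (count v1 (bids σ m))
optimal⇔maximal s1 s2 m σ m≤n = mk⇔ to from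
  where
  n = s1 + s2
  winProb-falling : ∀ τ → winProb s1 s2 m τ ≡
    frac (s1 ↓ count v2 (bids τ m) * s2 ↓ count v1 (bids τ m) * (n ∸ m) !) (n !)
  winProb-falling τ = trans (winProb-arrangements s1 s2 m τ m≤n)
    (cong (λ k → frac (s1 ↓ count v2 (bids τ m) * s2 ↓ count v1 (bids τ m) * (n ∸ k) !) (n !)) (count-bids τ m))
  to : Optimal s1 s2 m σ → Maximal s1 s2 (count v2 (bids σ m)) (count v1 (bids σ m))
  to optimal i r i+r≡b2+b1 with bids-realizable {i} {r} {m} (trans i+r≡b2+b1 (count-bids σ m))
  ... | τ , b2≡i , b1≡r = subst₂ (λ x y → s1 ↓ x * s2 ↓ y ≤ s1 ↓ count v2 (bids σ m) * s2 ↓ count v1 (bids σ m)) b2≡i b1≡r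
    (*-cancelʳ-≤ _ _ ((n ∸ m) !) {{(n ∸ m) !≢0}}
      (frac-cancel-≤ (1≤n! n) (subst₂ _≤ℚ_ (winProb-falling τ) (winProb-falling σ) (optimal τ))))
  from : Maximal s1 s2 (count v2 (bids σ m)) (count v1 (bids σ m)) → Optimal s1 s2 m σ
  from maximal τ = subst₂ _≤ℚ_ (sym (winProb-falling τ)) (sym (winProb-falling σ))
    (frac-mono-≤ {x = n !} (*-monoˡ-≤ ((n ∸ m) !) (maximal (count v2 (bids τ m)) (count v1 (bids τ m)) (trans (count-bids τ m) (sym (count-bids σ m))))))

winProb-binomial : ∀ s1 s2 m σ → m ≤ s1 + s2 →
  winProb s1 s2 m σ ≡ frac (binomℤ (s1 + s2 ∸ m) (+ s1 -ℤ + count v2 (bids σ m))) ((s1 + s2) C s1)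
winProb-binomial s1 s2 m σ m≤n = trans (winProb-arrangements s1 s2 m σ m≤n) (frac-cross (1≤n! n) (C-pos s1 s2)
  (subst (λ k → arrangements s1 s2 b2 b1 * (n C s1) ≡ binomℤ (n ∸ k) (+ s1 -ℤ + b2) * n !) (count-bids σ m)
         (arrangements-binomial s1 s2 b2 b1 (subst (_≤ n) (sym (count-bids σ m)) m≤n))))
  where
  n = s1 + s2
  b1 = count v1 (bids σ m)
  b2 = count v2 (bids σ m)

winProb≢0⇔ : ∀ s1 s2 m σ → m ≤ s1 + s2 →
  (¬ (winProb s1 s2 m σ ≡ 0ℚ)) ⇔ ((count v1 (bids σ m) ≤ s2) × (count v2 (bids σ m) ≤ s1))
winProb≢0⇔ s1 s2 m σ m≤n rewrite winProb-arrangements s1 s2 m σ m≤n =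
  ⇔.trans (frac≢0⇔pos (1≤n! (s1 + s2)))
          (⇔.trans (arrangements-pos⇔ s1 s2 (count v2 (bids σ m)) (count v1 (bids σ m))) (mk⇔ swap swap))

optimal⇔all-v2 : ∀ s1 s2 m σ → s2 + m ≤ s1 → Optimal s1 s2 m σ ⇔ All (_≡ v2) (bids σ m)
optimal⇔all-v2 s1 s2 m σ s2+m≤s1 = ⇔.trans (optimal⇔maximal s1 s2 m σ (≤-trans (m≤n+m m s2) (≤-trans s2+m≤s1 (m≤m+n s1 s2))))
  (⇔.trans (maximal⇔q≡0 s1 s2 (count v2 (bids σ m)) (count v1 (bids σ m))
                        (subst (λ k → s2 + k ≤ s1) (sym (count-bids σ m)) s2+m≤s1))
           (count-v1≡0⇔All-v2 (bids σ m)))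

optimal⇔balanced : ∀ s1 s2 m σ → m ≤ s1 + s2 → s1 ≤ suc (s2 + m) → s2 ≤ suc (s1 + m) →
  Optimal s1 s2 m σ ⇔ (∣ (+ s1 -ℤ + count v2 (bids σ m)) -ℤ (+ s2 -ℤ + count v1 (bids σ m)) ∣ ≤ 1)
optimal⇔balanced s1 s2 m σ m≤n s1≤ s2≤ = ⇔.trans (optimal⇔maximal s1 s2 m σ m≤n)
  (⇔.trans (maximal⇔balanced s1 s2 (on-line (λ k → s1 ≤ suc (s2 + k)) s1≤) (on-line (λ k → s2 ≤ suc (s1 + k)) s2≤)
                                    (on-line (_≤ s1 + s2) m≤n))
           (⇔.sym (∣[a-i]-[b-r]∣≤1⇔balanced s1 s2 (count v2 (bids σ m)) (count v1 (bids σ m)))))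
  where
  on-line : (P : ℕ → Set) → P m → P (count v2 (bids σ m) + count v1 (bids σ m))
  on-line P = subst P (sym (count-bids σ m))

proposition1p1 : (s1 s2 m : ℕ) → s2 ≤ s1 → 1 ≤ m → m ≤ s1 + s2 →
    (((σ : Strategy) →
      winProb s1 s2 m σ
        ≡ frac (binomℤ (s1 + s2 ∸ m) (+ s1 -ℤ + count v2 (bids σ m))) ((s1 + s2) C s1))
    × ((σ : Strategy) →
      (¬ (winProb s1 s2 m σ ≡ 0ℚ)) ⇔ ((count v1 (bids σ m) ≤ s2) × (count v2 (bids σ m) ≤ s1)))
    × (m ≤ s1 ∸ s2 → (σ : Strategy) →
      ((τ : Strategy) → winProb s1 s2 m τ ≤ℚ winProb s1 s2 m σ)
        ⇔ All (_≡ v2) (bids σ m))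
    × (¬ (m ≤ s1 ∸ s2) → (σ : Strategy) →
      ((τ : Strategy) → winProb s1 s2 m τ ≤ℚ winProb s1 s2 m σ)
        ⇔ (∣ (+ s1 -ℤ + count v2 (bids σ m)) -ℤ (+ s2 -ℤ + count v1 (bids σ m)) ∣ ≤ 1)))
proposition1p1 s1 s2 m s2≤s1 _ m≤n =
    (λ σ → winProb-binomial s1 s2 m σ m≤n)
  , (λ σ → winProb≢0⇔ s1 s2 m σ m≤n)
  , (λ m≤s1∸s2 σ → optimal⇔all-v2 s1 s2 m σ (subst (s2 + m ≤_) (m+[n∸m]≡n s2≤s1) (+-monoʳ-≤ s2 m≤s1∸s2)))
  , (λ m≰s1∸s2 σ → optimal⇔balanced s1 s2 m σ m≤n
                     (m≤n⇒m≤1+n (≤-trans (m≤n+m∸n s1 s2) (+-monoʳ-≤ s2 (<⇒≤ (≰⇒> m≰s1∸s2)))))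
                     (m≤n⇒m≤1+n (≤-trans s2≤s1 (m≤m+n s1 m))))
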